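{- There exist positive integers $n$ with arbitrarily many distinct prime factors such that $\gamma(X_n) \leq \gamma_t(X_n) \leq g(n) - 2$.
   Context: For a positive integer $n$, $X_n$ is the graph on $\{0,\dots,n-1\}$ with $a,b$ adjacent iff $\gcd(a-b,n)=1$. $g(n)$ (the Jacobsthal function) is the least positive integer $m$ such that every set of $m$ consecutive integers contains an integer coprime to $n$. $\gamma(G)$ is the minimum size of a dominating set of $G$ (a set $S$ such that every vertex is in $S$ or adjacent to a vertex of $S$), and the total domination number $\gamma_t(G)$ is the minimum size of a set $S$ such that every vertex of $G$ is adjacent to some member of $S$. -}

module Defs where

open import Data.Nat using (ℕ; zero; suc; _≤_; _<_)
open import Data.Nat.GCD using (gcd)
open import Data.Nat.Divisibility using (_∣_)
open import Data.Nat.Primality using (Prime)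
open import Data.Integer as ℤ using (ℤ; +_)
open import Data.Fin using (Fin; toℕ)
open import Data.Fin.Subset using (Subset; _∈_; ∣_∣)
open import Data.List using (List; length)
open import Data.List.Relation.Unary.All using (All)
open import Data.List.Relation.Unary.Unique.Propositional using (Unique)
open import Data.Product using (Σ; ∃; _×_)
open import Data.Sum using (_⊎_)
open import Relation.Binary.PropositionalEquality using (_≡_)

-- The graph X_n on vertex set {0,…,n-1} (= Fin n):
-- a ~ b iff gcd(a - b, n) = 1  (the difference taken in ℤ).
Adj : (n : ℕ) → Fin n → Fin n → Set
Adj n a b = gcd (ℤ.∣ (+ toℕ a) ℤ.- (+ toℕ b) ∣) n ≡ 1

IsDominating : (n : ℕ) → Subset n → Set
IsDominating n S = ∀ (v : Fin n) → v ∈ S ⊎ (Σ (Fin n) λ u → u ∈ S × Adj n u v)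

IsTotalDominating : (n : ℕ) → Subset n → Set
IsTotalDominating n S = ∀ (v : Fin n) → Σ (Fin n) λ u → u ∈ S × Adj n u v

DominationNumber : (n : ℕ) → ℕ → Set
DominationNumber n d =
  (Σ (Subset n) λ S → IsDominating n S × ∣ S ∣ ≡ d)
  × (∀ (S : Subset n) → IsDominating n S → d ≤ ∣ S ∣)

TotalDominationNumber : (n : ℕ) → ℕ → Set
TotalDominationNumber n t =
  (Σ (Subset n) λ S → IsTotalDominating n S × ∣ S ∣ ≡ t)
  × (∀ (S : Subset n) → IsTotalDominating n S → t ≤ ∣ S ∣)

ConsecutiveCoprime : (n m : ℕ) → Set
ConsecutiveCoprime n m =
  ∀ (a : ℤ) → Σ ℕ λ i → i < m × gcd (ℤ.∣ a ℤ.+ (+ i) ∣) n ≡ 1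

Jacobsthal : (n : ℕ) → ℕ → Set
Jacobsthal n j =
  0 < j × ConsecutiveCoprime n j
  × (∀ (m : ℕ) → 0 < m → ConsecutiveCoprime n m → j ≤ m)

AtLeastDistinctPrimeFactors : ℕ → ℕ → Set
AtLeastDistinctPrimeFactors k n =
  Σ (List ℕ) λ ps → length ps ≡ k × Unique ps × All Prime ps × All (_∣ n) ps

module Submission where

-- (1) `criterion`: if a list X of vertices totally dominates X_n (every v is at distance coprime
-- to n from some x ∈ X) and the |X| + 1 consecutive integers A, …, A + |X| are all non-coprime to n,
-- then γ ≤ γ_t ≤ |X| ≤ g(n) - 2. This needs the existence of γ, γ_t and g (least number principle;
-- for g, ConsecutiveCoprime over ℤ is reduced to the finitely many windows starting below n).
-- (2) For a parameter c, X = base ∪ [30, 30 + 30c) with a block `base` of 16 residues mod 30, so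
-- |X| = 16 + 30c, and every v is at distance coprime to 30 from at least 4 + 8c elements of X
-- (a finite check modulo 30, extended by periodicity).
-- (3) N = 30 · ∏ q_i, one prime q_i for each of the 3 + 8c offsets i < 17 + 30c with 20 + i coprime
-- to 30, chosen Euclid-style beyond a factorial so that q_i ∣ A + i for some A ≡ 20 (mod 30). Then
-- A, …, A + 16 + 30c all share a factor with N; each q_i > max X excludes at most one element of X,
-- so by pigeonhole some x ∈ X has ∣v - x∣ coprime to N. The q_i are distinct, giving c prime factors.

open import Defs
open import Function using (_∘_)
open import Data.Bool using (Bool; true; false; T)
open import Data.Empty using (⊥-elim)
open import Data.Product using (Σ; _×_; _,_; proj₁; proj₂; ∃-syntax)
open import Data.Sum using (_⊎_; inj₁; inj₂)
open import Relation.Nullary using (Dec; yes; no; ¬_; contradiction)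
open import Relation.Nullary.Decidable using (T?; ¬?; ⌊_⌋; from-yes; fromWitness; toWitness; _×-dec_; _⊎-dec_)
open import Relation.Binary.PropositionalEquality

open import Data.Nat using (ℕ; zero; suc; _+_; _*_; _∸_; ∣_-_∣; _%_; _/_; _!; _≤_; _<_; _≟_; _<?_; z≤n; s≤s;
  NonZero; >-nonZero; >-nonZero⁻¹; nonTrivial⇒n>1; nonTrivial⇒≢1)
open import Data.Nat.Properties
open import Data.Nat.DivMod
open import Data.Nat.Divisibility
open import Data.Nat.GCD using (gcd)
open import Data.Nat.Coprimality using (Coprime; coprime⇒gcd≡1; gcd≡1⇒coprime; coprime-divisor; coprime-+; 1-coprimeTo)
open import Data.Nat.Primality
open import Data.Nat.Primality.Factorisation using (PrimeFactorisation; factorise)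
open import Data.Nat.Combinatorics using (k![n∸k]!∣n!)
open import Data.Nat.ListAction using (product)
open import Data.Nat.ListAction.Properties using (∈⇒∣product)
import Data.Nat.Tactic.RingSolver as ℕ-Solver

import Data.Integer as ℤ
import Data.Integer.Properties as ℤ
open import Data.Integer.DivMod using (_%ℕ_; _/ℕ_; a≡a%ℕn+[a/ℕn]*n; n%ℕd<d)
import Data.Integer.Divisibility.Signed as ℤ∣
import Data.Integer.Tactic.RingSolver as ℤ-Solver

open import Data.List using (List; []; _∷_; _++_; length; filter; filterᵇ; map; take)
import Data.List.Properties as List
open import Data.List.Membership.Propositional using (_∈_)
open import Data.List.Membership.Propositional.Properties using (∈-filter⁻; ∈-filter⁺; ∈-++⁻; ∈-map⁺; ∈-map⁻)
open import Data.List.Relation.Unary.Any using (here; there)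
open import Data.List.Relation.Unary.All using (All; []; _∷_)
import Data.List.Relation.Unary.All as All
import Data.List.Relation.Unary.All.Properties as AllP
open import Data.List.Relation.Unary.AllPairs using ([]; _∷_; allPairs?)
open import Data.List.Relation.Unary.Unique.Propositional using (Unique)
import Data.List.Relation.Unary.Unique.Propositional.Properties as Unique

open import Data.Vec using ([]; _∷_)
open import Data.Fin using (Fin; toℕ; fromℕ<)
import Data.Fin.Properties as Fin
open import Data.Fin.Subset using (Subset; ∣_∣; _∪_; ⁅_⁆; ⊥; inside; outside)
import Data.Fin.Subset as Subset
open import Data.Fin.Subset.Properties using (_∈?_; anySubset?; x∈p∪q⁺; x∈⁅x⁆; ∣⁅x⁆∣≡1; ∣⊥∣≡0)

least : {P : ℕ → Set} → (∀ m → Dec (P m)) → ∀ m → P m →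
        ∃[ ℓ ] P ℓ × (∀ m′ → P m′ → ℓ ≤ m′)
least {P} P? m Pm with search (suc m)
  where
  search : ∀ b → (∀ m′ → P m′ → b ≤ m′) ⊎ (∃[ ℓ ] P ℓ × (∀ m′ → P m′ → ℓ ≤ m′))
  search zero = inj₁ (λ _ _ → z≤n)
  search (suc b) with search b
  ... | inj₂ found = inj₂ found
  ... | inj₁ none-below with P? b
  ...   | yes Pb = inj₂ (b , Pb , none-below)
  ...   | no ¬Pb = inj₁ λ m′ Pm′ → ≤∧≢⇒< (none-below m′ Pm′) (λ { refl → ¬Pb Pm′ })
... | inj₂ found = found
... | inj₁ none-below = contradiction (none-below m Pm) (<-irrefl refl)

∣[+m]-[+n]∣≡∣m-n∣ : ∀ m n → ℤ.∣ ℤ.+ m ℤ.- ℤ.+ n ∣ ≡ ∣ m - n ∣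
∣[+m]-[+n]∣≡∣m-n∣ m n = trans (cong ℤ.∣_∣ (ℤ.[+m]-[+n]≡m⊖n m n)) (∣m⊖n∣ m n)
  where
  ∣m⊖n∣ : ∀ m n → ℤ.∣ m ℤ.⊖ n ∣ ≡ ∣ m - n ∣
  ∣m⊖n∣ m n with ≤-total m n
  ... | inj₁ m≤n = trans (ℤ.∣⊖∣-≤ m≤n) (sym (m≤n⇒∣m-n∣≡n∸m m≤n))
  ... | inj₂ n≤m = trans (ℤ.∣m⊖n∣≡∣n⊖m∣ m n) (trans (ℤ.∣⊖∣-≤ n≤m) (sym (m≤n⇒∣n-m∣≡n∸m n≤m)))

∸-%-cong : ∀ {d} .{{_ : NonZero d}} {a b} → a ≤ b → d ∣ b ∸ a → b % d ≡ a % d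
∸-%-cong {d} {a} a≤b d∣ = trans (cong (_% d) (sym (m+[n∸m]≡n a≤b))) (%-remove-+ʳ a d∣)

∣∣m-n∣⇒%≡ : ∀ d .{{_ : NonZero d}} m n → d ∣ ∣ m - n ∣ → m % d ≡ n % d
∣∣m-n∣⇒%≡ d m n d∣ with ≤-total m n
... | inj₁ m≤n = sym (∸-%-cong m≤n (subst (d ∣_) (m≤n⇒∣m-n∣≡n∸m m≤n) d∣))
... | inj₂ n≤m = ∸-%-cong n≤m (subst (d ∣_) (m≤n⇒∣n-m∣≡n∸m n≤m) d∣)

∣∣v-x∣-unique : ∀ d .{{_ : NonZero d}} v {x y} → x < d → y < d → d ∣ ∣ v - x ∣ → d ∣ ∣ v - y ∣ → x ≡ y
∣∣v-x∣-unique d v {x} {y} x<d y<d d∣v-x d∣v-y = begin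
  x      ≡⟨ m<n⇒m%n≡m x<d ⟨
  x % d  ≡⟨ ∣∣m-n∣⇒%≡ d v x d∣v-x ⟨
  v % d  ≡⟨ ∣∣m-n∣⇒%≡ d v y d∣v-y ⟩
  y % d  ≡⟨ m<n⇒m%n≡m y<d ⟩
  y      ∎
  where open ≡-Reasoning

∣∧<⇒≡0 : ∀ {d x} → d ∣ x → x < d → x ≡ 0
∣∧<⇒≡0 {x = zero}  _   _   = refl
∣∧<⇒≡0 {x = suc _} d∣x x<d = contradiction (∣⇒≤ d∣x) (<⇒≱ x<d)

coprime-* : ∀ {a b c} → Coprime a b → Coprime a c → Coprime a (b * c)
coprime-* {a} {b} {c} a⊥b a⊥c (d∣a , d∣bc) =
  a⊥c (d∣a , coprime-divisor (λ (e∣d , e∣b) → a⊥b (∣-trans e∣d d∣a , e∣b)) d∣bc)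

coprime-product : ∀ {a} bs → All (Coprime a) bs → Coprime a (product bs)
coprime-product []       []           (_ , d∣1) = ∣1⇒≡1 d∣1
coprime-product (b ∷ bs) (a⊥b ∷ a⊥bs) = coprime-* a⊥b (coprime-product bs a⊥bs)

prime∤⇒coprime : ∀ {p a} → Prime p → ¬ p ∣ a → Coprime a p
prime∤⇒coprime p-prime p∤a (d∣a , d∣p) with prime⇒irreducible p-prime d∣p
... | inj₁ d≡1  = d≡1
... | inj₂ refl = contradiction d∣a p∤a

firstFactor : List ℕ → ℕ
firstFactor []      = 2
firstFactor (p ∷ _) = p

primeFactor : ℕ → ℕ
primeFactor zero        = 2
primeFactor n@(suc _)   = firstFactor (PrimeFactorisation.factors (factorise n))

primeFactor-spec : ∀ n → 2 ≤ n → Prime (primeFactor n) × primeFactor n ∣ n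
primeFactor-spec n@(suc _) 2≤n = first (factorise n)
  where
  first : (f : PrimeFactorisation n) →
          Prime (firstFactor (PrimeFactorisation.factors f)) × firstFactor (PrimeFactorisation.factors f) ∣ n
  first record { factors = [] ; isFactorisation = n≡1 } = contradiction n≡1 (>⇒≢ 2≤n)
  first record { factors = p ∷ ps ; isFactorisation = n≡∏ ; factorsPrime = p-prime ∷ _ } =
    p-prime , subst (p ∣_) (sym n≡∏) (∈⇒∣product {ns = p ∷ ps} (here refl))

∣! : ∀ {d} m → 1 ≤ d → d ≤ m → d ∣ m !
∣! {suc d} m _ d≤m = ∣-trans (m∣m*n (d !)) (∣-trans (m∣m*n ((m ∸ suc d) !)) (k![n∸k]!∣n! d≤m))

prime∣1+m!k⇒m<p : ∀ {p} m k → Prime p → p ∣ 1 + m ! * k → m < p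
prime∣1+m!k⇒m<p {p} m k p-prime p∣ with m <? p
... | yes m<p = m<p
... | no m≮p = contradiction (∣1⇒≡1 p∣1) (nonTrivial⇒≢1 {{prime⇒nonTrivial p-prime}})
  where
  p∣m!k : p ∣ m ! * k
  p∣m!k = ∣m⇒∣m*n k (∣! m (<⇒≤ (nonTrivial⇒n>1 p {{prime⇒nonTrivial p-prime}})) (≮⇒≥ m≮p))
  p∣1 : p ∣ 1
  p∣1 = ∣m+n∣m⇒∣n (subst (p ∣_) (+-comm 1 (m ! * k)) p∣) p∣m!k

MinimumSize : (n : ℕ) → (Subset n → Set) → ℕ → Set
MinimumSize n P m = (Σ (Subset n) λ S → P S × ∣ S ∣ ≡ m) × (∀ S → P S → m ≤ ∣ S ∣)

minimumSize : ∀ {n} {P : Subset n → Set} → (∀ S → Dec (P S)) → ∀ S → P S → ∃[ m ] MinimumSize n P m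
minimumSize {n} {P} P? S PS with least sizeAttained? ∣ S ∣ (S , PS , refl)
  where
  sizeAttained? : ∀ m → Dec (Σ (Subset n) λ S → P S × ∣ S ∣ ≡ m)
  sizeAttained? m = anySubset? (λ S → P? S ×-dec (∣ S ∣ ≟ m))
... | m , attained , minimal = m , attained , λ S′ PS′ → minimal ∣ S′ ∣ (S′ , PS′ , refl)

adjacent? : ∀ n u v → Dec (Adj n u v)
adjacent? n u v = gcd (ℤ.∣ ℤ.+ toℕ u ℤ.- ℤ.+ toℕ v ∣) n ≟ 1

totalDominating? : ∀ n S → Dec (IsTotalDominating n S)
totalDominating? n S = Fin.all? λ v → Fin.any? λ u → (u ∈? S) ×-dec adjacent? n u v

dominating? : ∀ n S → Dec (IsDominating n S)
dominating? n S = Fin.all? λ v → (v ∈? S) ⊎-dec Fin.any? λ u → (u ∈? S) ×-dec adjacent? n u v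

totalDominating⇒dominating : ∀ n S → IsTotalDominating n S → IsDominating n S
totalDominating⇒dominating n S total v = inj₂ (total v)

dominationNumbers : ∀ n S → IsTotalDominating n S →
  ∃[ d ] ∃[ t ] DominationNumber n d × TotalDominationNumber n t × d ≤ t
dominationNumbers n S total with minimumSize (totalDominating? n) S total
... | t , (St , St-total , ∣St∣≡t) , t-minimal with minimumSize (dominating? n) S (totalDominating⇒dominating n S total)
... | d , d-attained , d-minimal =
  d , t , (d-attained , d-minimal) , ((St , St-total , ∣St∣≡t) , t-minimal) ,
  subst (d ≤_) ∣St∣≡t (d-minimal St (totalDominating⇒dominating n St St-total))

residue-transfer : ∀ n .{{_ : NonZero n}} a i → Coprime (a %ℕ n + i) n → Coprime ℤ.∣ a ℤ.+ ℤ.+ i ∣ n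
residue-transfer n a i r+i⊥n {d} (d∣a+i , d∣n) = r+i⊥n (ℤ∣.∣⇒∣ᵤ d∣r+i , d∣n)
  where
  r = a %ℕ n
  q = a /ℕ n
  a+i≡ : a ℤ.+ ℤ.+ i ≡ (ℤ.+ r ℤ.+ ℤ.+ i) ℤ.+ q ℤ.* ℤ.+ n
  a+i≡ = trans (cong (ℤ._+ ℤ.+ i) (a≡a%ℕn+[a/ℕn]*n a n)) (rearrange (ℤ.+ r) (ℤ.+ i) (q ℤ.* ℤ.+ n))
    where
    rearrange : ∀ x y z → (x ℤ.+ z) ℤ.+ y ≡ (x ℤ.+ y) ℤ.+ z
    rearrange = ℤ-Solver.solve-∀
  d∣r+i : ℤ.+ d ℤ∣.∣ ℤ.+ r ℤ.+ ℤ.+ i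
  d∣r+i = ℤ∣.∣m+n∣n⇒∣m (subst (ℤ.+ d ℤ∣.∣_) a+i≡ (ℤ∣.∣ᵤ⇒∣ d∣a+i)) (ℤ∣.∣n⇒∣m*n q (ℤ∣.∣ᵤ⇒∣ d∣n))

WindowsCoprime : ℕ → ℕ → Set
WindowsCoprime n m = ∀ {r} → r < n → ∃[ i ] i < m × gcd (r + i) n ≡ 1

windowsCoprime? : ∀ n m → Dec (WindowsCoprime n m)
windowsCoprime? n m = allUpTo? (λ r → anyUpTo? (λ i → gcd (r + i) n ≟ 1) m) n

windows⇒consecutive : ∀ n .{{_ : NonZero n}} m → WindowsCoprime n m → ConsecutiveCoprime n m
windows⇒consecutive n m windows a with windows (n%ℕd<d a n)
... | i , i<m , gcd≡1 = i , i<m , coprime⇒gcd≡1 (residue-transfer n a i (gcd≡1⇒coprime gcd≡1))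

-- Among r, …, r + n there is always an integer coprime to n (namely 1 or n + 1).
windowsCoprime-suc : ∀ n → 1 ≤ n → WindowsCoprime n (suc n)
windowsCoprime-suc n 1≤n {zero}  _   = 1 , s≤s 1≤n , coprime⇒gcd≡1 (1-coprimeTo n)
windowsCoprime-suc n 1≤n {suc r} 1+r<n = suc n ∸ suc r , s≤s (m∸n≤m n r) ,
  subst (λ x → gcd x n ≡ 1) n+1≡ (coprime⇒gcd≡1 (coprime-+ (1-coprimeTo n)))
  where
  n+1≡ : n + 1 ≡ suc r + (suc n ∸ suc r)
  n+1≡ = trans (+-comm n 1) (sym (m+[n∸m]≡n (m≤n⇒m≤1+n (<⇒≤ 1+r<n))))

jacobsthal : ∀ n .{{_ : NonZero n}} → ∃[ j ] Jacobsthal n j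
jacobsthal n with least (λ m → (0 <? m) ×-dec windowsCoprime? n m) (suc n)
                        (s≤s z≤n , windowsCoprime-suc n (>-nonZero⁻¹ n))
... | j , (0<j , windows) , minimal =
  j , 0<j , windows⇒consecutive n j windows ,
  λ m 0<m consecutive → minimal m (0<m , λ {r} _ → consecutive (ℤ.+ r))

jacobsthal-lowerBound : ∀ {n j} A w → Jacobsthal n j → (∀ {i} → i < w → ¬ Coprime (A + i) n) → w < j
jacobsthal-lowerBound {n} {j} A w (_ , consecutive , _) noneCoprime with w <? j
... | yes w<j = w<j
... | no w≮j with consecutive (ℤ.+ A)
...   | i , i<j , gcd≡1 = ⊥-elim (noneCoprime (<-≤-trans i<j (≮⇒≥ w≮j)) (gcd≡1⇒coprime gcd≡1))

range : ℕ → ℕ → List ℕ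
range a zero    = []
range a (suc m) = a ∷ range (suc a) m

length-range : ∀ a m → length (range a m) ≡ m
length-range a zero    = refl
length-range a (suc m) = cong suc (length-range (suc a) m)

range-++ : ∀ a m k → range a (m + k) ≡ range a m ++ range (a + m) k
range-++ a zero    k = cong (λ b → range b k) (sym (+-identityʳ a))
range-++ a (suc m) k = cong (a ∷_) (trans (range-++ (suc a) m k) (cong (λ b → range (suc a) m ++ range b k) (sym (+-suc a m))))

∈-range⁻ : ∀ a m {x} → x ∈ range a m → a ≤ x × x < a + m
∈-range⁻ a (suc m) (here refl) = ≤-refl , subst (a <_) (sym (+-suc a m)) (s≤s (m≤m+n a m))
∈-range⁻ a (suc m) {x} (there x∈) with ∈-range⁻ (suc a) m x∈
... | a<x , x<1+a+m = <⇒≤ a<x , subst (x <_) (sym (+-suc a m)) x<1+a+m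

∈-range⁺ : ∀ a m {x} → a ≤ x → x < a + m → x ∈ range a m
∈-range⁺ a zero    a≤x x<a+0 = contradiction (≤-trans (≤-reflexive (+-identityʳ a)) a≤x) (<⇒≱ x<a+0)
∈-range⁺ a (suc m) {x} a≤x x<a+1+m with a ≟ x
... | yes refl = here refl
... | no a≢x   = there (∈-range⁺ (suc a) m (≤∧≢⇒< a≤x a≢x) (subst (x <_) (+-suc a m) x<a+1+m))

unique-range : ∀ a m → Unique (range a m)
unique-range a zero    = []
unique-range a (suc m) =
  All.tabulate (λ x∈ refl → <-irrefl refl (proj₁ (∈-range⁻ (suc a) m x∈))) ∷ unique-range (suc a) m

count : (ℕ → Bool) → List ℕ → ℕ
count b xs = length (filterᵇ b xs)

count-++ : ∀ b xs ys → count b (xs ++ ys) ≡ count b xs + count b ys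
count-++ b xs ys = trans (cong length (List.filter-++ (λ x → T? (b x)) xs ys)) (List.length-++ (filterᵇ b xs))

module Periodic (p : ℕ) (b : ℕ → Bool) (periodic : ∀ x → b (x + p) ≡ b x) where

  count-shift : ∀ a m → count b (range (a + p) m) ≡ count b (range a m)
  count-shift a zero = refl
  count-shift a (suc m) rewrite periodic a with b a
  ... | true  = cong suc (count-shift (suc a) m)
  ... | false = count-shift (suc a) m

  count-blocks : ∀ a c → count b (range a (p * c)) ≡ c * count b (range a p)
  count-blocks a zero = cong (λ m → count b (range a m)) (*-zeroʳ p)
  count-blocks a (suc c) = begin
    count b (range a (p * suc c))                        ≡⟨ cong (count b) (trans (cong (range a) (*-suc p c)) (range-++ a p (p * c))) ⟩
    count b (range a p ++ range (a + p) (p * c))         ≡⟨ count-++ b (range a p) _ ⟩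
    count b (range a p) + count b (range (a + p) (p * c)) ≡⟨ cong (count b (range a p) +_) (count-shift a (p * c)) ⟩
    count b (range a p) + count b (range a (p * c))       ≡⟨ cong (count b (range a p) +_) (count-blocks a c) ⟩
    count b (range a p) + c * count b (range a p)         ∎
    where open ≡-Reasoning

module Pigeonhole {A K : Set} (Kills : K → A → Set) (kills? : ∀ q x → Dec (Kills q x)) where

  KillsAtMostOne : K → List A → Set
  KillsAtMostOne q xs = ∀ {x y} → x ∈ xs → y ∈ xs → Kills q x → Kills q y → x ≡ y

  spares? : ∀ q x → Dec (¬ Kills q x)
  spares? q x = ¬? (kills? q x)

  survivors : K → List A → List A
  survivors q = filter (spares? q)

  length-survivors : ∀ q xs → Unique xs → KillsAtMostOne q xs → length xs ≤ suc (length (survivors q xs))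
  length-survivors q []       _             _       = z≤n
  length-survivors q (x ∷ xs) (x∉xs ∷ uniq) atMostOne with kills? q x
  ... | no _  = s≤s (length-survivors q xs uniq (λ x∈ y∈ → atMostOne (there x∈) (there y∈)))
  ... | yes q-kills-x =
    s≤s (≤-reflexive (cong length (sym (List.filter-all (spares? q) (All.tabulate spared)))))
    where
    spared : ∀ {y} → y ∈ xs → ¬ Kills q y
    spared y∈ q-kills-y = All.lookup x∉xs y∈ (atMostOne (here refl) (there y∈) q-kills-x q-kills-y)

  survivor : ∀ qs xs → Unique xs → (∀ {q} → q ∈ qs → KillsAtMostOne q xs) → length qs < length xs →
             ∃[ x ] x ∈ xs × All (λ q → ¬ Kills q x) qs
  survivor []       (x ∷ _) _    _         _  = x , here refl , []
  survivor (q ∷ qs) xs      uniq atMostOne qs<xs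
    with survivor qs (survivors q xs) (Unique.filter⁺ (spares? q) uniq)
           (λ q∈ x∈ y∈ → atMostOne (there q∈) (proj₁ (∈-filter⁻ (spares? q) x∈)) (proj₁ (∈-filter⁻ (spares? q) y∈)))
           (≤-pred (≤-trans qs<xs (length-survivors q xs uniq (atMostOne (here refl)))))
  ... | x , x∈survivors , spared =
    let x∈xs , spared-by-q = ∈-filter⁻ (spares? q) {xs = xs} x∈survivors in x , x∈xs , spared-by-q ∷ spared

unique-map : ∀ (f : ℕ → ℕ) xs → Unique xs → (∀ {x y} → x ∈ xs → y ∈ xs → f x ≡ f y → x ≡ y) → Unique (map f xs)
unique-map f []       []            _         = []
unique-map f (x ∷ xs) (x∉xs ∷ uniq) injective =
  AllP.map⁺ (All.tabulate λ y∈ fx≡fy → All.lookup x∉xs y∈ (injective (here refl) (there y∈) fx≡fy)) ∷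
  unique-map f xs uniq (λ x∈ y∈ → injective (there x∈) (there y∈))

∣p∪q∣≤∣p∣+∣q∣ : ∀ {n} (p q : Subset n) → ∣ p ∪ q ∣ ≤ ∣ p ∣ + ∣ q ∣
∣p∪q∣≤∣p∣+∣q∣ []            []            = z≤n
∣p∪q∣≤∣p∣+∣q∣ (outside ∷ p) (outside ∷ q) = ∣p∪q∣≤∣p∣+∣q∣ p q
∣p∪q∣≤∣p∣+∣q∣ (outside ∷ p) (inside ∷ q)  = subst (suc ∣ p ∪ q ∣ ≤_) (sym (+-suc ∣ p ∣ ∣ q ∣)) (s≤s (∣p∪q∣≤∣p∣+∣q∣ p q))
∣p∪q∣≤∣p∣+∣q∣ (inside ∷ p)  (outside ∷ q) = s≤s (∣p∪q∣≤∣p∣+∣q∣ p q)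
∣p∪q∣≤∣p∣+∣q∣ (inside ∷ p)  (inside ∷ q)  = s≤s (≤-trans (∣p∪q∣≤∣p∣+∣q∣ p q) (≤-trans (n≤1+n _) (≤-reflexive (sym (+-suc ∣ p ∣ ∣ q ∣)))))

module _ {n : ℕ} where

  toSubset : (xs : List ℕ) → All (_< n) xs → Subset n
  toSubset []       []          = ⊥
  toSubset (x ∷ xs) (x<n ∷ xs<n) = ⁅ fromℕ< x<n ⁆ ∪ toSubset xs xs<n

  ∣toSubset∣≤length : ∀ xs xs<n → ∣ toSubset xs xs<n ∣ ≤ length xs
  ∣toSubset∣≤length []       []          = ≤-reflexive (∣⊥∣≡0 n)
  ∣toSubset∣≤length (x ∷ xs) (x<n ∷ xs<n) = ≤-trans (∣p∪q∣≤∣p∣+∣q∣ ⁅ fromℕ< x<n ⁆ (toSubset xs xs<n))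
    (+-mono-≤ (≤-reflexive (∣⁅x⁆∣≡1 (fromℕ< x<n))) (∣toSubset∣≤length xs xs<n))

  ∈-toSubset : ∀ xs xs<n {x} → x ∈ xs → Σ (Fin n) λ u → toℕ u ≡ x × u Subset.∈ toSubset xs xs<n
  ∈-toSubset (y ∷ xs) (y<n ∷ xs<n) (here refl) = fromℕ< y<n , Fin.toℕ-fromℕ< y<n , x∈p∪q⁺ (inj₁ (x∈⁅x⁆ _))
  ∈-toSubset (y ∷ xs) (y<n ∷ xs<n) (there x∈) with ∈-toSubset xs xs<n x∈
  ... | u , u≡x , u∈ = u , u≡x , x∈p∪q⁺ (inj₂ u∈)

  totalDominatingSubset : ∀ xs xs<n → (∀ v → ∃[ x ] x ∈ xs × Coprime ∣ v - x ∣ n) →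
                          IsTotalDominating n (toSubset xs xs<n)
  totalDominatingSubset xs xs<n dominated v with dominated (toℕ v)
  ... | x , x∈ , coprime with ∈-toSubset xs xs<n x∈
  ...   | u , refl , u∈ = u , u∈ , subst (λ δ → gcd δ n ≡ 1) distance (coprime⇒gcd≡1 coprime)
    where
    distance : ∣ toℕ v - toℕ u ∣ ≡ ℤ.∣ ℤ.+ toℕ u ℤ.- ℤ.+ toℕ v ∣
    distance = trans (∣-∣-comm (toℕ v) (toℕ u)) (sym (∣[+m]-[+n]∣≡∣m-n∣ (toℕ u) (toℕ v)))

criterion : ∀ n → 0 < n → ∀ xs (xs<n : All (_< n) xs) → (∀ v → ∃[ x ] x ∈ xs × Coprime ∣ v - x ∣ n) →
            ∀ A → (∀ {i} → i < suc (length xs) → ¬ Coprime (A + i) n) →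
            Σ ℕ λ d → Σ ℕ λ t → Σ ℕ λ j →
              DominationNumber n d × TotalDominationNumber n t × Jacobsthal n j × d ≤ t × t + 2 ≤ j
criterion n 0<n xs xs<n dominated A noneCoprime =
  combine (dominationNumbers n S total) (jacobsthal n {{>-nonZero 0<n}})
  where
  S : Subset n
  S = toSubset xs xs<n
  total : IsTotalDominating n S
  total = totalDominatingSubset xs xs<n dominated
  combine : (∃[ d ] ∃[ t ] DominationNumber n d × TotalDominationNumber n t × d ≤ t) → ∃[ j ] Jacobsthal n j →
            Σ ℕ λ d → Σ ℕ λ t → Σ ℕ λ j →
              DominationNumber n d × TotalDominationNumber n t × Jacobsthal n j × d ≤ t × t + 2 ≤ j
  combine (d , t , γ , γt , d≤t) (j , g) = d , t , j , γ , γt , g , d≤t , (begin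
    t + 2                 ≤⟨ +-monoˡ-≤ 2 (proj₂ γt S total) ⟩
    ∣ S ∣ + 2             ≤⟨ +-monoˡ-≤ 2 (∣toSubset∣≤length xs xs<n) ⟩
    length xs + 2         ≡⟨ +-comm (length xs) 2 ⟩
    2 + length xs         ≤⟨ jacobsthal-lowerBound A (suc (length xs)) g noneCoprime ⟩
    j                     ∎)
    where open ≤-Reasoning

Residues : Set
Residues = ℕ × ℕ × ℕ

residues : ℕ → Residues
residues x = x % 2 , x % 3 , x % 5

residues-+30 : ∀ x → residues (x + 30) ≡ residues x
residues-+30 x = cong₂ _,_ ([m+kn]%n≡m%n x 15 2) (cong₂ _,_ ([m+kn]%n≡m%n x 10 3) ([m+kn]%n≡m%n x 6 5))

residues-%30 : ∀ x → residues (x % 30) ≡ residues x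
residues-%30 x = cong₂ _,_ (m∣n⇒o%n%m≡o%m 2 30 x (divides 15 refl))
  (cong₂ _,_ (m∣n⇒o%n%m≡o%m 3 30 x (divides 10 refl)) (m∣n⇒o%n%m≡o%m 5 30 x (divides 6 refl)))

Differ : Residues → Residues → Set
Differ (a , b , c) (a′ , b′ , c′) = a ≢ a′ × b ≢ b′ × c ≢ c′

differ? : ∀ r s → Dec (Differ r s)
differ? (a , b , c) (a′ , b′ , c′) = ¬? (a ≟ a′) ×-dec ¬? (b ≟ b′) ×-dec ¬? (c ≟ c′)

-- far v x: v and x differ modulo 2, 3 and 5, so that ∣ v - x ∣ is coprime to 30.
-- In particular far y 0 says that y itself is coprime to 30.
far : ℕ → ℕ → Bool
far v x = ⌊ differ? (residues v) (residues x) ⌋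

far-sound : ∀ v x → T (far v x) → Coprime ∣ v - x ∣ 30
far-sound v x far-v-x with toWitness {a? = differ? (residues v) (residues x)} far-v-x
... | v≢x%2 , v≢x%3 , v≢x%5 =
  coprime-* (prime∤⇒coprime prime[2] (coprime-mod 2 v≢x%2))
    (coprime-* (prime∤⇒coprime (from-yes (prime? 3)) (coprime-mod 3 v≢x%3))
               (prime∤⇒coprime (from-yes (prime? 5)) (coprime-mod 5 v≢x%5)))
  where
  coprime-mod : ∀ p .{{_ : NonZero p}} → v % p ≢ x % p → ¬ p ∣ ∣ v - x ∣
  coprime-mod p v≢x p∣ = v≢x (∣∣m-n∣⇒%≡ p v x p∣)

far-complete : ∀ y → ¬ T (far y 0) → (2 ∣ y) ⊎ (3 ∣ y) ⊎ (5 ∣ y)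
far-complete y ¬far with (2 ∣? y) ⊎-dec (3 ∣? y) ⊎-dec (5 ∣? y)
... | yes divisible  = divisible
... | no ¬divisible = contradiction (fromWitness {a? = differ? (residues y) (residues 0)} coprime) ¬far
  where
  coprime : Differ (residues y) (residues 0)
  coprime = (λ r → ¬divisible (inj₁ (m%n≡0⇒n∣m y 2 r))) ,
            (λ r → ¬divisible (inj₂ (inj₁ (m%n≡0⇒n∣m y 3 r)))) ,
            (λ r → ¬divisible (inj₂ (inj₂ (m%n≡0⇒n∣m y 5 r))))

far-+30ʳ : ∀ v x → far v (x + 30) ≡ far v x
far-+30ʳ v x = cong (λ r → ⌊ differ? (residues v) r ⌋) (residues-+30 x)

far-+30ˡ : ∀ y x → far (y + 30) x ≡ far y x
far-+30ˡ y x = cong (λ r → ⌊ differ? r (residues x) ⌋) (residues-+30 y)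

far-%30 : ∀ v → far (v % 30) ≡ far v
far-%30 v = cong (λ r x → ⌊ differ? r (residues x) ⌋) (residues-%30 v)

-- The base block: 16 residues such that every number is far from at least 4 of them.
base : List ℕ
base = 0 ∷ 1 ∷ 6 ∷ 11 ∷ 13 ∷ 14 ∷ 15 ∷ 19 ∷ 20 ∷ 22 ∷ 23 ∷ 24 ∷ 26 ∷ 27 ∷ 28 ∷ 29 ∷ []

-- Finite verification over the residue classes modulo 30: each v is far from at least 4 elements
-- of base and from exactly 8 of 0, …, 29 (the φ(30) = 8 residues coprime to 30, shifted by v).
base-check : All (λ v → 4 ≤ count (far v) base × count (far v) (range 0 30) ≡ 8) (range 0 30)
base-check = from-yes (All.all? (λ v → (4 ≤? count (far v) base) ×-dec (count (far v) (range 0 30) ≟ 8)) (range 0 30))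

base<30 : All (_< 30) base
base<30 = from-yes (All.all? (_<? 30) base)

dominators : ℕ → List ℕ
dominators c = base ++ range 30 (30 * c)

length-dominators : ∀ c → length (dominators c) ≡ 16 + 30 * c
length-dominators c = trans (List.length-++ base {range 30 (30 * c)}) (cong (16 +_) (length-range 30 (30 * c)))

dominators< : ∀ c {x} → x ∈ dominators c → x < 30 + 30 * c
dominators< c x∈ with ∈-++⁻ base x∈
... | inj₁ x∈base  = ≤-trans (All.lookup base<30 x∈base) (m≤m+n 30 (30 * c))
... | inj₂ x∈range = proj₂ (∈-range⁻ 30 (30 * c) x∈range)

unique-dominators : ∀ c → Unique (dominators c)
unique-dominators c = Unique.++⁺ unique-base (unique-range 30 (30 * c)) disjoint
  where
  unique-base : Unique base
  unique-base = from-yes (allPairs? (λ x y → ¬? (x ≟ y)) base)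
  disjoint : ∀ {x} → ¬ (x ∈ base × x ∈ range 30 (30 * c))
  disjoint (x∈base , x∈range) =
    <⇒≱ (All.lookup base<30 x∈base) (proj₁ (∈-range⁻ 30 (30 * c) x∈range))

-- Every v is far from at least 4 + 8c of the dominators: 4 in the base block, 8 in each full block.
count-far-dominators : ∀ c v → 4 + 8 * c ≤ count (far v) (dominators c)
count-far-dominators c v = subst (λ b → 4 + 8 * c ≤ count b (dominators c)) (far-%30 v) (begin
  4 + 8 * c                                        ≤⟨ +-monoˡ-≤ (8 * c) (proj₁ check) ⟩
  count b base + 8 * c                             ≡⟨ cong (count b base +_) (*-comm 8 c) ⟩
  count b base + c * 8                             ≡⟨ cong (λ m → count b base + c * m) (proj₂ check) ⟨
  count b base + c * count b (range 0 30)          ≡⟨ cong (λ m → count b base + c * m) (count-shift 0 30) ⟨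
  count b base + c * count b (range 30 30)         ≡⟨ cong (count b base +_) (count-blocks 30 c) ⟨
  count b base + count b (range 30 (30 * c))       ≡⟨ count-++ b base (range 30 (30 * c)) ⟨
  count b (dominators c)                           ∎)
  where
  open ≤-Reasoning
  b = far (v % 30)
  open Periodic 30 b (far-+30ʳ (v % 30))
  check = All.lookup base-check (∈-range⁺ 0 30 z≤n (m%n<n v 30))

window : ℕ → ℕ
window c = 17 + 30 * c

offset? : ℕ → Bool
offset? i = far (20 + i) 0

offsets : ℕ → List ℕ
offsets c = filterᵇ offset? (range 0 (window c))

length-offsets : ∀ c → length (offsets c) ≡ 3 + 8 * c
length-offsets c = begin
  count offset? (range 0 (17 + 30 * c))                     ≡⟨ cong (count offset?) (range-++ 0 17 (30 * c)) ⟩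
  count offset? (range 0 17 ++ range 17 (30 * c))           ≡⟨ count-++ offset? (range 0 17) (range 17 (30 * c)) ⟩
  3 + count offset? (range 17 (30 * c))                     ≡⟨ cong (3 +_) (count-blocks 17 c) ⟩
  3 + c * 8                                                  ≡⟨ cong (3 +_) (*-comm c 8) ⟩
  3 + 8 * c                                                  ∎
  where
  open ≡-Reasoning
  open Periodic 30 offset? (λ i → trans (cong (λ y → far y 0) (sym (+-assoc 20 i 30))) (far-+30ˡ (20 + i) 0))

offsets< : ∀ c {i} → i ∈ offsets c → i < window c
offsets< c i∈ = proj₂ (∈-range⁻ 0 (window c) (proj₁ (∈-filter⁻ (T? ∘ offset?) i∈)))

common-divisor⇒¬coprime : ∀ {p a b} → 2 ≤ p → p ∣ a → p ∣ b → ¬ Coprime a b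
common-divisor⇒¬coprime 2≤p p∣a p∣b coprime = <⇒≢ 2≤p (sym (coprime (p∣a , p∣b)))

-- With bound = 20 + window c, F = bound! and A = 20 + 30F², every
-- offset i (so 20 + i ≤ bound) gives A + i = (20 + i) · cofactor i, where cofactor i = 1 + F · 30 · F/(20 + i)
-- has a prime factor q i > bound. N = 30 · ∏ q i over the offsets, so each A + i in the window
-- shares a factor with N: 2, 3 or 5 if 20 + i is not coprime to 30, and q i otherwise.
module Construction (c : ℕ) where

  -- bound is kept opaque: only the two facts below are used, and unfolding it inside the
  -- factorial F = bound ! would make the type checker expand a huge product.
  opaque
    bound : ℕ
    bound = 20 + window c

    20+i≤bound : ∀ {i} → i < window c → 20 + i ≤ bound
    20+i≤bound i<w = +-monoʳ-≤ 20 (<⇒≤ i<w)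

    30+30c<bound : 30 + 30 * c < bound
    30+30c<bound = +-monoˡ-≤ (30 * c) (m≤n+m 31 6)

  -- Offsets are below bound, so primes beyond bound exceed every distance between offsets.
  window<bound : ∀ {i} → i < window c → i < bound
  window<bound {i} i<w = <-≤-trans (m<n+m i (s≤s z≤n)) (20+i≤bound i<w)

  F : ℕ
  F = bound !

  A : ℕ
  A = 20 + 30 * (F * F)

  cofactor : ℕ → ℕ
  cofactor i = 1 + F * (30 * (F / (20 + i)))

  q : ℕ → ℕ
  q i = primeFactor (cofactor i)

  primes : List ℕ
  primes = map q (offsets c)

  N : ℕ
  N = 30 * product primes

  module _ {i} (i<w : i < window c) where

    20+i∣F : 20 + i ∣ F
    20+i∣F = ∣! bound (s≤s z≤n) (20+i≤bound i<w)

    cofactor-spec : (20 + i) * cofactor i ≡ A + i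
    cofactor-spec = begin
      (20 + i) * cofactor i                          ≡⟨ expand i F (F / (20 + i)) ⟩
      20 + 30 * (F * (F / (20 + i) * (20 + i))) + i  ≡⟨ cong (λ x → 20 + 30 * (F * x) + i) (m/n*n≡m 20+i∣F) ⟩
      A + i                                          ∎
      where
      open ≡-Reasoning
      expand : ∀ i F K → (20 + i) * (1 + F * (30 * K)) ≡ 20 + 30 * (F * (K * (20 + i))) + i
      expand = ℕ-Solver.solve-∀

    2≤cofactor : 2 ≤ cofactor i
    2≤cofactor = s≤s (*-mono-≤ (1≤n! bound) (*-mono-≤ {1} {30} (s≤s z≤n) quotient-positive))
      where
      quotient-positive : 1 ≤ F / (20 + i)
      quotient-positive = m≥n⇒m/n>0 (∣⇒≤ {{bound !≢0}} 20+i∣F)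

    q-prime : Prime (q i)
    q-prime = proj₁ (primeFactor-spec (cofactor i) 2≤cofactor)

    q∣cofactor : q i ∣ cofactor i
    q∣cofactor = proj₂ (primeFactor-spec (cofactor i) 2≤cofactor)

    bound<q : bound < q i
    bound<q = prime∣1+m!k⇒m<p bound (30 * (F / (20 + i))) q-prime q∣cofactor

    q∣A+i : q i ∣ A + i
    q∣A+i = ∣-trans q∣cofactor (subst (cofactor i ∣_) cofactor-spec (n∣m*n (20 + i)))

  primes-spec : ∀ {p} → p ∈ primes → Prime p × bound < p
  primes-spec p∈ with ∈-map⁻ q p∈
  ... | i , i∈ , refl = q-prime (offsets< c i∈) , bound<q (offsets< c i∈)

  -- Distinct offsets give distinct primes: if q i = q j with i ≤ j, it divides j - i < q j.
  same-prime⇒same-offset : ∀ {i j} → i ≤ j → i < window c → j < window c → q i ≡ q j → j ≡ i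
  same-prime⇒same-offset {i} {j} i≤j i<w j<w qi≡qj = ≤-antisym (m∸n≡0⇒m≤n (∣∧<⇒≡0 q∣j∸i j∸i<q)) i≤j
    where
    q∣j∸i : q j ∣ j ∸ i
    q∣j∸i = ∣m+n∣m⇒∣n (subst (q j ∣_) A+j≡ (q∣A+i j<w)) (subst (_∣ A + i) qi≡qj (q∣A+i i<w))
      where
      A+j≡ : A + j ≡ (A + i) + (j ∸ i)
      A+j≡ = trans (cong (A +_) (sym (m+[n∸m]≡n i≤j))) (sym (+-assoc A i (j ∸ i)))
    j∸i<q : j ∸ i < q j
    j∸i<q = ≤-<-trans (m∸n≤m j i) (<-trans (window<bound j<w) (bound<q j<w))

  q-injective : ∀ {i j} → i < window c → j < window c → q i ≡ q j → i ≡ j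
  q-injective {i} {j} i<w j<w qi≡qj with ≤-total i j
  ... | inj₁ i≤j = sym (same-prime⇒same-offset i≤j i<w j<w qi≡qj)
  ... | inj₂ j≤i = same-prime⇒same-offset j≤i j<w i<w (sym qi≡qj)

  -- A common factor p ≥ 2 of 20 + i and 30 divides both A + i = (20 + i) + 30F² and N.
  small-factor : ∀ {i p} → 2 ≤ p → p ∣ 20 + i → p ∣ 30 → ¬ Coprime (A + i) N
  small-factor {i} {p} 2≤p p∣20+i p∣30 = common-divisor⇒¬coprime 2≤p
    (subst (p ∣_) (rearrange i (30 * (F * F))) (∣m∣n⇒∣m+n p∣20+i (∣m⇒∣m*n (F * F) p∣30)))
    (∣m⇒∣m*n (product primes) p∣30)
    where
    rearrange : ∀ i x → (20 + i) + x ≡ 20 + x + i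
    rearrange = ℕ-Solver.solve-∀

  window-covered : ∀ {i} → i < window c → ¬ Coprime (A + i) N
  window-covered {i} i<w = covered (T? (offset? i))
    where
    covered : Dec (T (offset? i)) → ¬ Coprime (A + i) N
    covered (yes coprime30) = common-divisor⇒¬coprime (nonTrivial⇒n>1 (q i) {{prime⇒nonTrivial (q-prime i<w)}})
      (q∣A+i i<w) (∣n⇒∣m*n 30 (∈⇒∣product (∈-map⁺ q (∈-filter⁺ (T? ∘ offset?) (∈-range⁺ 0 (window c) z≤n i<w) coprime30))))
    covered (no ¬coprime30) = shared-small-prime (far-complete (20 + i) ¬coprime30)
      where
      shared-small-prime : (2 ∣ 20 + i) ⊎ (3 ∣ 20 + i) ⊎ (5 ∣ 20 + i) → ¬ Coprime (A + i) N
      shared-small-prime (inj₁ 2∣)        = small-factor (s≤s (s≤s z≤n)) 2∣ (divides 15 refl)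
      shared-small-prime (inj₂ (inj₁ 3∣)) = small-factor (s≤s (s≤s z≤n)) 3∣ (divides 10 refl)
      shared-small-prime (inj₂ (inj₂ 5∣)) = small-factor (s≤s (s≤s z≤n)) 5∣ (divides 6 refl)

  0<N : 0 < N
  0<N = *-mono-≤ {1} {30} (s≤s z≤n) (productOfPrimes≥1 (All.tabulate (proj₁ ∘ primes-spec)))

  -- N exceeds every dominator: already its factor q 3 does (20 + 3 = 23 is coprime to 30).
  dominators<N : All (_< N) (dominators c)
  dominators<N = All.tabulate λ x∈ → <-trans (dominators< c x∈) (<-≤-trans 30+30c<q3 q3≤N)
    where
    3<w : 3 < window c
    3<w = s≤s (s≤s (s≤s (s≤s z≤n)))
    30+30c<q3 : 30 + 30 * c < q 3
    30+30c<q3 = <-trans 30+30c<bound (bound<q 3<w)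
    q3≤N : q 3 ≤ N
    q3≤N = ≤-trans (∣⇒≤ {{productOfPrimes≢0 (All.tabulate (proj₁ ∘ primes-spec))}} (∈⇒∣product q3∈)) (m≤n*m _ 30)
      where
      q3∈ : q 3 ∈ primes
      q3∈ = ∈-map⁺ q (∈-filter⁺ (T? ∘ offset?) (∈-range⁺ 0 (window c) z≤n 3<w) _)

  -- Every v is at distance coprime to N from some dominator: among the ≥ 4 + 8c dominators far from v
  -- (distance coprime to 30), each of the 3 + 8c primes q i > bound divides the distance of at most one.
  dominated : ∀ v → ∃[ x ] x ∈ dominators c × Coprime ∣ v - x ∣ N
  dominated v = spared⇒coprime (survivor primes candidates
                  (Unique.filter⁺ (T? ∘ far v) (unique-dominators c)) atMostOne fewer)
    where
    open Pigeonhole (λ p x → p ∣ ∣ v - x ∣) (λ p x → p ∣? ∣ v - x ∣)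
    candidates : List ℕ
    candidates = filterᵇ (far v) (dominators c)
    atMostOne : ∀ {p} → p ∈ primes → KillsAtMostOne p candidates
    atMostOne p∈ x∈ y∈ = ∣∣v-x∣-unique _ {{prime⇒nonZero (proj₁ (primes-spec p∈))}} v (below x∈) (below y∈)
      where
      below : ∀ {x} → x ∈ candidates → x < _
      below x∈ = <-trans (dominators< c (proj₁ (∈-filter⁻ (T? ∘ far v) x∈)))
                         (<-trans 30+30c<bound (proj₂ (primes-spec p∈)))
    fewer : length primes < length candidates
    fewer = begin-strict
      length primes          ≡⟨ List.length-map q (offsets c) ⟩
      length (offsets c)     ≡⟨ length-offsets c ⟩
      3 + 8 * c              <⟨ ≤-refl ⟩
      4 + 8 * c              ≤⟨ count-far-dominators c v ⟩
      length candidates      ∎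
      where open ≤-Reasoning
    spared⇒coprime : (∃[ x ] x ∈ candidates × All (λ p → ¬ p ∣ ∣ v - x ∣) primes) →
                     ∃[ x ] x ∈ dominators c × Coprime ∣ v - x ∣ N
    spared⇒coprime (x , x∈ , spared) = x , proj₁ x-far , coprime-* (far-sound v x (proj₂ x-far))
      (coprime-product primes (All.tabulate λ p∈ → prime∤⇒coprime (proj₁ (primes-spec p∈)) (All.lookup spared p∈)))
      where
      x-far = ∈-filter⁻ (T? ∘ far v) {xs = dominators c} x∈

  distinctPrimeFactors : AtLeastDistinctPrimeFactors c N
  distinctPrimeFactors =
    take c primes , length-take , Unique.take⁺ c distinct ,
    AllP.take⁺ c (All.tabulate (proj₁ ∘ primes-spec)) ,
    AllP.take⁺ c (All.tabulate λ p∈ → ∣n⇒∣m*n 30 (∈⇒∣product p∈))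
    where
    distinct : Unique primes
    distinct = unique-map q (offsets c) (Unique.filter⁺ (T? ∘ offset?) (unique-range 0 (window c)))
                          (λ i∈ j∈ → q-injective (offsets< c i∈) (offsets< c j∈))
    length-take : length (take c primes) ≡ c
    length-take = trans (List.length-take c primes) (m≤n⇒m⊓n≡m c≤length)
      where
      c≤length : c ≤ length primes
      c≤length = subst (c ≤_) (sym (trans (List.length-map q (offsets c)) (length-offsets c)))
                       (≤-trans (m≤n*m c 8) (m≤n+m (8 * c) 3))

corollary3p2 : ∀ (k : ℕ) → Σ ℕ λ n → 0 < n × AtLeastDistinctPrimeFactors k n
    × Σ ℕ λ d → Σ ℕ λ t → Σ ℕ λ j →
    DominationNumber n d × TotalDominationNumber n t × Jacobsthal n j
    × d ≤ t × t + 2 ≤ j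
corollary3p2 k = N , 0<N , distinctPrimeFactors ,
  criterion N 0<N (dominators k) dominators<N dominated A
    (λ {i} i<1+|X| → window-covered (subst (i <_) (cong suc (length-dominators k)) i<1+|X|))
  where open Construction k
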